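{- For all $i\ge 0$, $D(n-1,i)=\mathrm{ED}(n-1,i)$.
   Context: Let $n$ be a power of two, let $F$ be a string of length $n$, and let $S=S[0]S[1]\cdots$ be a stream string over the same alphabet. The DAG has nodes $(j,i)$ with $j\in\{ -1,\dots,n-1\}$ and $i\in\{ -1,0,1,\dots\}$. Each node $(j,i)$ has the following outgoing edges: - a horizontal edge to $(j,i+1)$, of weight $1$ except weight $0$ when $j=-1$; - when $j\le n-2$, a vertical edge to $(j+1,i)$ of weight $1$; - when $j\le n-2$, a diagonal edge to $(j+1,i+1)$ of weight $0$ if $F[j+1]=S[i+1]$ and weight $1$ otherwise. For nodes $u,u'$, $\|u\rightsquigarrow u'\|$ is the minimum weight of a path from $u$ to $u'$ ($\infty$ if there is none). $\mathrm{ED}(j,i)=\|(-1,-1)\rightsquigarrow(j,i)\|$. For a positive integer $i$, $\mathrm{predecessor}(i)$ is $i$ with its least significant $1$-bit set to $0$. Define $\rho(i)=\mathrm{predecessor}(i)$ if $\mathrm{predecessor}(i)>i-n$, and $\rho(i)=i-n$ otherwise. Note $\rho(i)<i$. Values $D(j,i)\in\mathbb{N}\cup\{\infty\}$ are defined by recursion on $i$: - $D(j,0)=\mathrm{ED}(j,0)$ for all $j$. - For $i\ge1$, first set $\widetilde D(j,i)=\min_{j'\in\{ -1,\dots,n-1\}}\big(D(j',\rho(i))+\|(j',\rho(i))\rightsquigarrow(j,i)\|\big)$. - Blocks: the sequence $\widetilde D(n-1,i),\widetilde D(n-2,i),\dots,\widetilde D(-1,i)$ is split greedily from left to right into blocks.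 A finite value continues the current block exactly when that block consists of finite values and the value equals the previous value minus $1$. An $\infty$ value continues the current block exactly when the previous value is $\infty$. Otherwise a new block starts. - $\mathrm{block}(j,i)$ is the 1-based index of the block containing $\widetilde D(j,i)$. - $D(j,i)=\widetilde D(j,i)$ if $\mathrm{block}(j,i)\le 3(i-\rho(i))$, and $D(j,i)=\infty$ otherwise. -}

module Defs where

open import Data.Nat using (ℕ; zero; suc; _+_; _*_; _∸_; _⊓_; _≡ᵇ_; _<ᵇ_; _≤ᵇ_)
open import Data.Nat.Base using (⌊_/2⌋)
open import Data.Nat.Properties using (_<?_)
open import Data.Fin using (Fin; fromℕ<)
open import Data.List using (List; []; _∷_; map; concatMap; foldr; upTo; downFrom; zip)
open import Data.Maybe using (Maybe; just; nothing)
open import Data.Product using (_×_; _,_)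
open import Data.Bool using (Bool; true; false; if_then_else_; _∧_)
open import Relation.Nullary using (yes; no; does)
open import Relation.Binary.Definitions using (DecidableEquality)

data ℕ∞ : Set where
  fin : ℕ → ℕ∞
  ∞   : ℕ∞

_⊕_ : ℕ∞ → ℕ∞ → ℕ∞
fin x ⊕ fin y = fin (x + y)
_     ⊕ _     = ∞

min∞ : ℕ∞ → ℕ∞ → ℕ∞
min∞ (fin x) (fin y) = fin (x ⊓ y)
min∞ ∞       y       = y
min∞ (fin x) ∞       = fin x

minimum∞ : List ℕ∞ → ℕ∞
minimum∞ = foldr min∞ ∞

isFin : ℕ∞ → Bool
isFin (fin _) = true
isFin ∞       = false

odd : ℕ → Bool
odd zero          = false
odd (suc zero)    = true
odd (suc (suc m)) = odd m

-- first argument is fuel; clearLSB k i is correct whenever i ≤ k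
clearLSB : ℕ → ℕ → ℕ
clearLSB zero    i = i
clearLSB (suc k) i = if odd i then i ∸ 1 else 2 * clearLSB k ⌊ i /2⌋

predecessor : ℕ → ℕ
predecessor i = clearLSB i i

-- ρ(i) = predecessor(i) if predecessor(i) > i - n (integer subtraction),
--        i - n otherwise (then i ≥ n, so ∸ is exact)
ρ : ℕ → ℕ → ℕ
ρ n i = if i <ᵇ predecessor i + n then predecessor i else i ∸ n

-- Greedy block decomposition of a sequence of ℕ∞ values.
-- Returns the (1-based) block index of every element.

-- does v continue the current block?  bf = current block consists of
-- finite values; p = previous value
continues : Bool → ℕ∞ → ℕ∞ → Bool
continues true (fin y) (fin x) = suc x ≡ᵇ y
continues _    ∞       ∞       = true
continues _    _       _       = false

blocksGo : ℕ → Bool → ℕ∞ → List ℕ∞ → List ℕ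
blocksGo k bf p []       = []
blocksGo k bf p (v ∷ vs) =
  if continues bf p v
  then k ∷ blocksGo k (bf ∧ isFin v) v vs
  else suc k ∷ blocksGo (suc k) (isFin v) v vs

blocks : List ℕ∞ → List ℕ
blocks []       = []
blocks (v ∷ vs) = 1 ∷ blocksGo 1 (isFin v) v vs

lookupKey : ℕ → List (ℕ × ℕ) → ℕ
lookupKey a []             = 0
lookupKey a ((x , k) ∷ xs) = if a ≡ᵇ x then k else lookupKey a xs

-- The DAG.  Coordinates are shifted by one: the node (j , i) of the
-- paper (j ∈ {-1..n-1}, i ∈ {-1,0,..}) is represented by (a , b) with
-- a = j + 1, b = i + 1.

data Move : Set where
  H V Dg : Move

allMoves : List Move
allMoves = H ∷ V ∷ Dg ∷ []

movesUpTo : ℕ → List (List Move)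
movesUpTo zero    = [] ∷ []
movesUpTo (suc k) = [] ∷ concatMap (λ m → map (m ∷_) (movesUpTo k)) allMoves

module Setup {A : Set} (_≟A_ : DecidableEquality A) (n : ℕ)
             (F : Fin n → A) (S : ℕ → A) where

  -- one edge out of node (a , b): target and weight (nothing if no such edge)
  step : ℕ → ℕ → Move → Maybe (ℕ × ℕ × ℕ)
  step zero    b H = just (zero , suc b , 0)        -- j = -1: weight 0
  step (suc a) b H = just (suc a , suc b , 1)
  step a b V with a <? n                            -- j ≤ n-2
  ... | yes _ = just (suc a , b , 1)
  ... | no  _ = nothing
  step a b Dg with a <? n
  ... | yes p = just (suc a , suc b ,
                      (if does (F (fromℕ< p) ≟A S b) then 0 else 1))  -- F[j+1] vs S[i+1]
  ... | no  _ = nothing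

  walk : ℕ → ℕ → List Move → Maybe (ℕ × ℕ × ℕ)
  walk a b []       = just (a , b , 0)
  walk a b (m ∷ ms) with step a b m
  ... | nothing            = nothing
  ... | just (a' , b' , w) with walk a' b' ms
  ...   | nothing               = nothing
  ...   | just (a'' , b'' , w') = just (a'' , b'' , w + w')

  pathWeight : ℕ → ℕ → ℕ → ℕ → List Move → ℕ∞
  pathWeight a b a' b' ms with walk a b ms
  ... | nothing          = ∞
  ... | just (x , y , w) = if (x ≡ᵇ a') ∧ (y ≡ᵇ b') then fin w else ∞

  -- Every edge
  -- increases a + b, so every path has at most (a' ∸ a) + (b' ∸ b) edges,
  -- and all paths are among the enumerated move lists.
  dist : ℕ → ℕ → ℕ → ℕ → ℕ∞
  dist a b a' b' = minimum∞ (map (pathWeight a b a' b') (movesUpTo ((a' ∸ a) + (b' ∸ b))))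

  -- ED(j , i) with a = j + 1
  ED : ℕ → ℕ → ℕ∞
  ED a i = dist 0 0 a (suc i)

  -- block(j , i) for a row given as a function of a = j + 1; the sequence is
  -- taken in the order a = n, n-1, ..., 0 (i.e. j = n-1, ..., -1)
  blockOf : (ℕ → ℕ∞) → ℕ → ℕ
  blockOf row a = lookupKey a (zip (downFrom (suc n)) (blocks (map row (downFrom (suc n)))))

  -- D̃(· , i) from the row D(· , r) with r = ρ(i)
  Dtilde : (ℕ → ℕ∞) → ℕ → ℕ → (ℕ → ℕ∞)
  Dtilde prev r i a =
    minimum∞ (map (λ a' → prev a' ⊕ dist a' (suc r) a (suc i)) (upTo (suc n)))

  -- first argument is fuel (adequate whenever i ≤ fuel, since ρ(i) < i)
  Drow : ℕ → ℕ → (ℕ → ℕ∞)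
  Drow _       zero    a = ED a 0
  Drow zero    (suc i) a = ∞
  Drow (suc k) (suc i) a =
    let r  = ρ n (suc i)
        dt = Dtilde (Drow k r) r (suc i)
    in if blockOf dt a ≤ᵇ 3 * (suc i ∸ r) then dt a else ∞

  -- D(j , i) with a = j + 1
  D : ℕ → ℕ → ℕ∞
  D a i = Drow i i a

module Submission where

-- Write gap(i) = i − ρ(i) for the width of the stripe that column i is computed from.  We prove,
-- by induction along the recursion i ↦ ρ(i), two invariants of the row D(· , i):
--   Sound: ED(a , i) ≤ D(a , i) for every row a, since every candidate in the minimum defining
--          D̃(a , i) is the weight of a genuine path from the source;
--   Exact: D(a , i) = ED(a , i) on the "slack band" of rows a with
--          ED(a , i) + (n − a) < ED(n , i) + 3·gap(i).
-- For Exact, an optimal path to a slack row crosses column ρ(i) in a row that is again slack for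
-- ρ(i), because stripe widths at least double along the ρ-chain until they reach n (this is where
-- n being a power of two enters); so D̃ is exact on the band.  On the band ED rises by at most one
-- per row, which bounds the number of blocks above a and so keeps a under the 3·gap(i) threshold.
-- The last row is always in the band, which gives the theorem.

open import Defs
open import Data.Nat using (ℕ; zero; suc; _+_; _*_; _∸_; _^_; _≤_; _<_; z≤n; s≤s; _≡ᵇ_; _<ᵇ_; _≤ᵇ_)
open import Data.Nat.Properties
open import Data.Nat.Divisibility using (_∣_; divides; ∣-trans; ∣⇒≤; ∣m+n∣m⇒∣n; ∣m∣n⇒∣m+n; *-monoʳ-∣; ∣-refl)
open import Data.Nat.Tactic.RingSolver using (solve-∀)
open import Data.Fin using (Fin)
open import Data.List using (List; []; _∷_; map; length; replicate; upTo; downFrom; zip; _++_)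
open import Data.List.Membership.Propositional using (_∈_)
open import Data.List.Membership.Propositional.Properties using (∈-map⁺; ∈-concatMap⁺; ∈-upTo⁺; ∈-upTo⁻)
open import Data.List.Relation.Unary.Any using (Any; here; there)
open import Data.Maybe using (just)
open import Data.Product using (∃; _×_; _,_; proj₂)
open import Data.Sum using (_⊎_; inj₁; inj₂; reduce)
open import Data.Bool using (true; false; T; if_then_else_)
open import Data.Unit using (⊤; tt)
open import Data.Empty using (⊥; ⊥-elim)
open import Function using (_∘_)
open import Relation.Binary.PropositionalEquality
open import Relation.Binary.Definitions using (DecidableEquality)
open import Relation.Nullary using (yes; no)

infix 4 _≤∞_

_≤∞_ : ℕ∞ → ℕ∞ → Set
_     ≤∞ ∞     = ⊤
fin x ≤∞ fin y = x ≤ y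
∞     ≤∞ fin _ = ⊥

≤∞-refl : ∀ x → x ≤∞ x
≤∞-refl (fin x) = ≤-refl
≤∞-refl ∞       = tt

≤∞-trans : ∀ x y z → x ≤∞ y → y ≤∞ z → x ≤∞ z
≤∞-trans (fin x) (fin y) (fin z) p q = ≤-trans p q
≤∞-trans _       _       ∞       p q = tt
≤∞-trans (fin x) ∞       (fin z) p ()
≤∞-trans ∞       (fin y) (fin z) () q
≤∞-trans ∞       ∞       (fin z) p ()

≤∞-fin : ∀ x w → x ≤∞ fin w → ∃ λ e → x ≡ fin e × e ≤ w
≤∞-fin (fin e) w p = e , refl , p

≤∞-antisym-fin : ∀ x e → fin e ≤∞ x → x ≤∞ fin e → x ≡ fin e
≤∞-antisym-fin (fin x) e p q = cong fin (≤-antisym q p)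

⊕-mono-≤∞ : ∀ x x' y y' → x ≤∞ x' → y ≤∞ y' → x ⊕ y ≤∞ x' ⊕ y'
⊕-mono-≤∞ (fin x) (fin x') (fin y) (fin y') p q = +-mono-≤ p q
⊕-mono-≤∞ _       ∞        _       _        p q = tt
⊕-mono-≤∞ (fin x) (fin x') _       ∞        p q = tt

value : ℕ∞ → ℕ
value (fin x) = x
value ∞       = 0

min∞-≤ˡ : ∀ x y → min∞ x y ≤∞ x
min∞-≤ˡ (fin x) (fin y) = m⊓n≤m x y
min∞-≤ˡ (fin x) ∞       = ≤-refl
min∞-≤ˡ ∞       y       = tt

min∞-≤ʳ : ∀ x y → min∞ x y ≤∞ y
min∞-≤ʳ (fin x) (fin y) = m⊓n≤n x y
min∞-≤ʳ (fin x) ∞       = tt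
min∞-≤ʳ ∞       y       = ≤∞-refl y

min∞-glb : ∀ v x y → v ≤∞ x → v ≤∞ y → v ≤∞ min∞ x y
min∞-glb (fin v) (fin x) (fin y) p q = ⊓-glb p q
min∞-glb (fin v) (fin x) ∞       p q = p
min∞-glb (fin v) ∞       y       p q = q
min∞-glb ∞       ∞       y       p q = q

min∞-sel : ∀ x y w → min∞ x y ≡ fin w → x ≡ fin w ⊎ y ≡ fin w
min∞-sel (fin x) (fin y) w e with ⊓-sel x y
... | inj₁ p = inj₁ (trans (cong fin (sym p)) e)
... | inj₂ p = inj₂ (trans (cong fin (sym p)) e)
min∞-sel (fin x) ∞ w e = inj₁ e
min∞-sel ∞       y w e = inj₂ e

module _ {X : Set} (f : X → ℕ∞) where

  minimum∞-≤ : ∀ {xs x} → x ∈ xs → minimum∞ (map f xs) ≤∞ f x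
  minimum∞-≤ {y ∷ xs} (here refl) = min∞-≤ˡ (f y) _
  minimum∞-≤ {y ∷ xs} {x} (there x∈xs) =
    ≤∞-trans (minimum∞ (map f (y ∷ xs))) _ (f x) (min∞-≤ʳ (f y) _) (minimum∞-≤ x∈xs)

  minimum∞-glb : ∀ xs v → (∀ {x} → x ∈ xs → v ≤∞ f x) → v ≤∞ minimum∞ (map f xs)
  minimum∞-glb []       (fin v) h = tt
  minimum∞-glb []       ∞       h = tt
  minimum∞-glb (y ∷ xs) v       h = min∞-glb v (f y) _ (h (here refl)) (minimum∞-glb xs v (h ∘ there))


  minimum∞-attained : ∀ xs w → minimum∞ (map f xs) ≡ fin w → ∃ λ x → x ∈ xs × f x ≡ fin w
  minimum∞-attained (y ∷ xs) w e with min∞-sel (f y) _ w e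
  ... | inj₁ p = y , here refl , p
  ... | inj₂ p with minimum∞-attained xs w p
  ...   | x , x∈xs , q = x , there x∈xs , q

data Parity : ℕ → Set where
  double   : ∀ m → Parity (m + m)
  double+1 : ∀ m → Parity (suc (m + m))

parity : ∀ j → Parity j
parity zero = double 0
parity (suc zero) = double+1 0
parity (suc (suc j)) with parity j
... | double m   rewrite sym (+-suc m m) = double (suc m)
... | double+1 m rewrite sym (+-suc m m) = double+1 (suc m)

odd-double : ∀ m → odd (m + m) ≡ false
odd-double zero = refl
odd-double (suc m) rewrite +-suc m m = odd-double m

odd-suc-double : ∀ m → odd (suc (m + m)) ≡ true
odd-suc-double zero = refl
odd-suc-double (suc m) rewrite +-suc m m = odd-suc-double m

double≡2* : ∀ m → m + m ≡ 2 * m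
double≡2* m = cong (m +_) (sym (+-identityʳ m))

pow-∣ : ∀ {a b} → a ≤ b → 2 ^ a ∣ 2 ^ b
pow-∣ {a} {b} a≤b = divides (2 ^ (b ∸ a)) (begin
  2 ^ b               ≡⟨ cong (2 ^_) (m+[n∸m]≡n a≤b) ⟨
  2 ^ (a + (b ∸ a))   ≡⟨ ^-distribˡ-+-* 2 a (b ∸ a) ⟩
  2 ^ a * 2 ^ (b ∸ a) ≡⟨ *-comm (2 ^ a) _ ⟩
  2 ^ (b ∸ a) * 2 ^ a ∎)
  where open ≡-Reasoning

pow-≤⇒∣ : ∀ a b → 2 ^ a ≤ 2 ^ b → 2 ^ a ∣ 2 ^ b
pow-≤⇒∣ a b le with a ≤? b
... | yes a≤b = pow-∣ a≤b
... | no a≰b  = ⊥-elim (<⇒≱ (^-monoʳ-< 2 (s≤s (s≤s z≤n)) (≰⇒> a≰b)) le)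

record LowBit (j p v : ℕ) : Set where
  constructor lowBit
  field
    split : j ≡ p + 2 ^ v
    above : 2 ^ suc v ∣ p

clearLSB-lowBit : ∀ k j → 1 ≤ j → j ≤ k → ∃ λ v → LowBit j (clearLSB k j) v
clearLSB-lowBit zero j 1≤j j≤0 = ⊥-elim (<⇒≱ 1≤j j≤0)
clearLSB-lowBit (suc k) j 1≤j j≤k with parity j
... | double+1 m rewrite odd-suc-double m =
  0 , lowBit (sym (+-comm (m + m) 1)) (divides m (trans (double≡2* m) (*-comm 2 m)))
... | double m rewrite odd-double m | sym (n≡⌊n+n/2⌋ m)
  with clearLSB-lowBit k m (half-pos m 1≤j) (half-≤ m j≤k)
  where
  half-pos : ∀ m → 1 ≤ m + m → 1 ≤ m
  half-pos (suc m) _ = s≤s z≤n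
  half-≤ : ∀ m → m + m ≤ suc k → m ≤ k
  half-≤ zero _ = z≤n
  half-≤ (suc m) le = ≤-trans (s≤s (m≤m+n m m)) (subst (_≤ k) (+-suc m m) (≤-pred le))
... | v , lowBit m≡p+2^v ∣p = suc v , lowBit split (*-monoʳ-∣ 2 ∣p)
  where
  p : ℕ
  p = clearLSB k m
  split : m + m ≡ 2 * p + 2 ^ suc v
  split = begin
    m + m             ≡⟨ double≡2* m ⟩
    2 * m             ≡⟨ cong (2 *_) m≡p+2^v ⟩
    2 * (p + 2 ^ v)   ≡⟨ *-distribˡ-+ 2 p (2 ^ v) ⟩
    2 * p + 2 ^ suc v ∎
    where open ≡-Reasoning

lowBit-max : ∀ {j p v} a → LowBit j p v → 2 ^ a ∣ j → 2 ^ a ≤ 2 ^ v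
lowBit-max {j} {p} {v} a (lowBit j≡p+2^v ∣p) ∣j with a ≤? v
... | yes a≤v = ^-monoʳ-≤ 2 a≤v
... | no a≰v  = ⊥-elim (<⇒≱ (^-monoʳ-< 2 (s≤s (s≤s z≤n)) (n<1+n v)) (∣⇒≤ {{m^n≢0 2 v}} ∣2^v))
  where
  ∣2^v : 2 ^ suc v ∣ 2 ^ v
  ∣2^v = ∣m+n∣m⇒∣n (subst (2 ^ suc v ∣_) j≡p+2^v (∣-trans (pow-∣ (≰⇒> a≰v)) ∣j)) ∣p

gap : ℕ → ℕ → ℕ
gap n i = i ∸ ρ n i

data RhoShape (n i : ℕ) : Set where
  clear    : ∀ {p v} → LowBit i p v → 2 ^ v < n → ρ n i ≡ p → RhoShape n i
  subtract : ∀ {p v} → LowBit i p v → n ≤ 2 ^ v → ρ n i ≡ i ∸ n → RhoShape n i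

ρ-shape : ∀ n i → 1 ≤ i → RhoShape n i
ρ-shape n i 1≤i with clearLSB-lowBit i i 1≤i ≤-refl
... | v , lb@(lowBit i≡p+2^v _) with i <ᵇ predecessor i + n in test
... | true  = clear lb (+-cancelˡ-< p (2 ^ v) n i<p+n) (cong (λ b → if b then p else i ∸ n) test)
  where
  p : ℕ
  p = predecessor i
  i<p+n : p + 2 ^ v < p + n
  i<p+n = subst (_< p + n) i≡p+2^v (<ᵇ⇒< i (p + n) (subst T (sym test) tt))
... | false = subtract lb n≤2^v (cong (λ b → if b then p else i ∸ n) test)
  where
  p : ℕ
  p = predecessor i
  n≤2^v : n ≤ 2 ^ v
  n≤2^v with n ≤? 2 ^ v
  ... | yes le = le
  ... | no n≰2^v = ⊥-elim (subst T test (<⇒<ᵇ (subst (_< p + n) (sym i≡p+2^v) (+-monoʳ-< p (≰⇒> n≰2^v)))))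

lowBit-≤ : ∀ {j p v} → LowBit j p v → 2 ^ v ≤ j
lowBit-≤ {p = p} {v} (lowBit j≡p+2^v _) = subst (2 ^ v ≤_) (sym j≡p+2^v) (m≤n+m (2 ^ v) p)

gap-clear : ∀ {n i p v} → LowBit i p v → ρ n i ≡ p → gap n i ≡ 2 ^ v
gap-clear {n} {i} {p} {v} (lowBit i≡p+2^v _) ρ≡p = begin
  i ∸ ρ n i       ≡⟨ cong₂ _∸_ i≡p+2^v ρ≡p ⟩
  p + 2 ^ v ∸ p   ≡⟨ m+n∸m≡n p (2 ^ v) ⟩
  2 ^ v           ∎
  where open ≡-Reasoning

gap-subtract : ∀ {n i} → n ≤ i → ρ n i ≡ i ∸ n → gap n i ≡ n
gap-subtract {n} {i} n≤i ρ≡i∸n = trans (cong (i ∸_) ρ≡i∸n) (m∸[m∸n]≡n n≤i)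

ρ< : ∀ n i → 1 ≤ n → 1 ≤ i → ρ n i < i
ρ< n i 1≤n 1≤i with ρ-shape n i 1≤i
... | clear {p} {v} (lowBit i≡p+2^v _) _ ρ≡p =
  subst₂ _<_ (sym ρ≡p) (sym i≡p+2^v) (m<m+n p (m^n>0 2 v))
... | subtract lb n≤2^v ρ≡i∸n =
  subst (_< i) (sym ρ≡i∸n) (∸-monoʳ-< 1≤n (≤-trans n≤2^v (lowBit-≤ lb)))

gap-divisor : ∀ n r a → 1 ≤ r → 2 ^ a ∣ r → 2 ^ a ≤ gap n r ⊎ n ≤ gap n r
gap-divisor n r a 1≤r ∣r with ρ-shape n r 1≤r
... | clear lb _ ρ≡p = inj₁ (subst (2 ^ a ≤_) (sym (gap-clear lb ρ≡p)) (lowBit-max a lb ∣r))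
... | subtract lb n≤2^v ρ≡r∸n =
  inj₂ (≤-reflexive (sym (gap-subtract (≤-trans n≤2^v (lowBit-≤ lb)) ρ≡r∸n)))

gap-growth : ∀ K i → 1 ≤ i →
             ρ (2 ^ K) i ≡ 0 ⊎ 2 * gap (2 ^ K) i ≤ gap (2 ^ K) (ρ (2 ^ K) i) ⊎ 2 ^ K ≤ gap (2 ^ K) (ρ (2 ^ K) i)
gap-growth K i 1≤i with ρ-shape (2 ^ K) i 1≤i
... | clear {zero} lb _ ρ≡0 = inj₁ ρ≡0
... | clear {suc p} {v} lb _ ρ≡p with gap-divisor (2 ^ K) (suc p) (suc v) (s≤s z≤n) (LowBit.above lb)
...   | inj₁ le = inj₂ (inj₁ (subst₂ (λ g r → 2 * g ≤ gap (2 ^ K) r) (sym (gap-clear lb ρ≡p)) (sym ρ≡p) le))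
...   | inj₂ le = inj₂ (inj₂ (subst (λ r → 2 ^ K ≤ gap (2 ^ K) r) (sym ρ≡p) le))
gap-growth K i 1≤i | subtract {p} {v} lb@(lowBit i≡p+2^v ∣p) n≤2^v ρ≡i∸n = rest (i ∸ 2 ^ K) refl
  where
  n : ℕ
  n = 2 ^ K
  n∣i : n ∣ i
  n∣i = ∣-trans (pow-≤⇒∣ K v n≤2^v)
                (subst (2 ^ v ∣_) (sym i≡p+2^v) (∣m∣n⇒∣m+n (∣-trans (pow-∣ (n≤1+n v)) ∣p) ∣-refl))
  n∣i∸n : n ∣ i ∸ n
  n∣i∸n = ∣m+n∣m⇒∣n (subst (n ∣_) (sym (m+[n∸m]≡n (≤-trans n≤2^v (lowBit-≤ lb)))) n∣i) ∣-refl
  -- i − n is again a multiple of n, so its own stripe has the full width n unless it is 0.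
  rest : ∀ r → i ∸ n ≡ r → ρ n i ≡ 0 ⊎ 2 * gap n i ≤ gap n (ρ n i) ⊎ n ≤ gap n (ρ n i)
  rest zero    r≡0 = inj₁ (trans ρ≡i∸n r≡0)
  rest (suc r) r≡  = inj₂ (inj₂ (subst (λ r → n ≤ gap n r) (sym (trans ρ≡i∸n r≡))
    (reduce (gap-divisor n (suc r) K (s≤s z≤n) (subst (n ∣_) r≡ n∣i∸n)))))

movesUpTo-complete : ∀ L ms → length ms ≤ L → ms ∈ movesUpTo L
movesUpTo-complete zero    []       _       = here refl
movesUpTo-complete (suc L) []       _       = here refl
movesUpTo-complete (suc L) (m ∷ ms) (s≤s p) =
  there (∈-concatMap⁺ (λ m' → map (m' ∷_) (movesUpTo L)) (first-move m (∈-map⁺ (m ∷_) (movesUpTo-complete L ms p))))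
  where
  first-move : ∀ m → (m ∷ ms) ∈ map (m ∷_) (movesUpTo L) →
               Any (λ m' → (m ∷ ms) ∈ map (m' ∷_) (movesUpTo L)) allMoves
  first-move H  q = here q
  first-move V  q = there (here q)
  first-move Dg q = there (there (here q))

module Paths {A : Set} (_≟A_ : DecidableEquality A) (n : ℕ) (F : Fin n → A) (S : ℕ → A) where
  open Setup _≟A_ n F S

  data Walk : ℕ → ℕ → List Move → ℕ → ℕ → ℕ → Set where
    []  : ∀ {a b} → Walk a b [] a b 0
    _∷_ : ∀ {a b m ms a₁ b₁ w₁ x y w} → step a b m ≡ just (a₁ , b₁ , w₁) →
          Walk a₁ b₁ ms x y w → Walk a b (m ∷ ms) x y (w₁ + w)

  walk-sound : ∀ {a b ms x y w} → Walk a b ms x y w → walk a b ms ≡ just (x , y , w)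
  walk-sound []      = refl
  walk-sound (e ∷ p) rewrite e | walk-sound p = refl

  walk-complete : ∀ a b ms {x y w} → walk a b ms ≡ just (x , y , w) → Walk a b ms x y w
  walk-complete a b [] refl = []
  walk-complete a b (m ∷ ms) eq with step a b m in e
  ... | just (a₁ , b₁ , w₁) with walk a₁ b₁ ms in e'
  walk-complete a b (m ∷ ms) refl | just (a₁ , b₁ , w₁) | just _ = e ∷ walk-complete a₁ b₁ ms e'

  _++ʷ_ : ∀ {a b ms x y w ms' x' y' w'} → Walk a b ms x y w → Walk x y ms' x' y' w' →
          Walk a b (ms ++ ms') x' y' (w + w')
  []      ++ʷ q = q
  _++ʷ_ {w' = w'} (_∷_ {w₁ = w₁} {w = w} e p) q = subst (Walk _ _ _ _ _) (sym (+-assoc w₁ w w')) (e ∷ (p ++ʷ q))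

  data Edge (a b : ℕ) : ℕ → ℕ → ℕ → Set where
    horizontal : ∀ {w} → Edge a b a (suc b) w
    vertical   : a < n → Edge a b (suc a) b 1
    diagonal   : ∀ {w} → a < n → Edge a b (suc a) (suc b) w

  edge : ∀ a b m {a₁ b₁ w₁} → step a b m ≡ just (a₁ , b₁ , w₁) → Edge a b a₁ b₁ w₁
  edge zero    b H refl = horizontal
  edge (suc a) b H refl = horizontal
  edge zero    b V e with 0 <? n
  edge zero    b V refl | yes 0<n = vertical 0<n
  edge (suc a) b V e with suc a <? n
  edge (suc a) b V refl | yes a<n = vertical a<n
  edge zero    b Dg e with 0 <? n
  edge zero    b Dg refl | yes 0<n = diagonal 0<n
  edge (suc a) b Dg e with suc a <? n
  edge (suc a) b Dg refl | yes a<n = diagonal a<n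

  record EdgeBounds (a b a₁ b₁ w₁ : ℕ) : Set where
    field
      rows     : a ≤ a₁
      columns  : b ≤ b₁
      column+1 : b₁ ≤ suc b
      progress : suc (a + b) ≤ a₁ + b₁
      in-grid  : a ≤ n → a₁ ≤ n
      descent  : a₁ + b ≤ a + b₁ + w₁

  edge-bounds : ∀ {a b a₁ b₁ w₁} → Edge a b a₁ b₁ w₁ → EdgeBounds a b a₁ b₁ w₁
  edge-bounds {a} {b} {w₁ = w₁} horizontal = record
    { rows = ≤-refl ; columns = n≤1+n b ; column+1 = ≤-refl
    ; progress = ≤-reflexive (sym (+-suc a b)) ; in-grid = λ p → p
    ; descent = ≤-trans (+-monoʳ-≤ a (n≤1+n b)) (m≤m+n (a + suc b) w₁) }
  edge-bounds {a} {b} (vertical a<n) = record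
    { rows = n≤1+n a ; columns = ≤-refl ; column+1 = n≤1+n b
    ; progress = ≤-refl ; in-grid = λ _ → a<n ; descent = ≤-reflexive (+-comm 1 (a + b)) }
  edge-bounds {a} {b} {w₁ = w₁} (diagonal a<n) = record
    { rows = n≤1+n a ; columns = n≤1+n b ; column+1 = ≤-refl
    ; progress = s≤s (≤-trans (n≤1+n (a + b)) (≤-reflexive (sym (+-suc a b)))) ; in-grid = λ _ → a<n
    ; descent = ≤-trans (≤-reflexive (sym (+-suc a b))) (m≤m+n (a + suc b) w₁) }

  record WalkBounds (a b : ℕ) (ms : List Move) (x y w : ℕ) : Set where
    field
      rows    : a ≤ x
      columns : b ≤ y
      length≤ : length ms + (a + b) ≤ x + y
      in-grid : a ≤ n → x ≤ n
      descent : x + b ≤ a + y + w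

  walk-bounds : ∀ {a b ms x y w} → Walk a b ms x y w → WalkBounds a b ms x y w
  walk-bounds [] = record
    { rows = ≤-refl ; columns = ≤-refl ; length≤ = ≤-refl ; in-grid = λ p → p ; descent = m≤m+n _ 0 }
  walk-bounds {a} {b} {_ ∷ ms} {x} {y} (_∷_ {a₁ = a₁} {b₁} {w₁} {w = w} e p) = record
    { rows    = ≤-trans (E.rows st) (W.rows ih)
    ; columns = ≤-trans (E.columns st) (W.columns ih)
    ; length≤ = ≤-trans (≤-reflexive (sym (+-suc (length ms) (a + b))))
                        (≤-trans (+-monoʳ-≤ (length ms) (E.progress st)) (W.length≤ ih))
    ; in-grid = W.in-grid ih ∘ E.in-grid st
    ; descent = +-cancelʳ-≤ (a₁ + b₁) _ _
                  (subst₂ _≤_ (shuffleˡ x b₁ a₁ b) (shuffleʳ a₁ y w a b₁ w₁)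
                    (+-mono-≤ (W.descent ih) (E.descent st))) }
    where
    module E = EdgeBounds
    module W = WalkBounds
    st : EdgeBounds a b a₁ b₁ w₁
    st = edge-bounds (edge a b _ e)
    ih : WalkBounds a₁ b₁ ms x y w
    ih = walk-bounds p
    shuffleˡ : ∀ x b₁ a₁ b → x + b₁ + (a₁ + b) ≡ x + b + (a₁ + b₁)
    shuffleˡ = solve-∀
    shuffleʳ : ∀ a₁ y w a b₁ w₁ → a₁ + y + w + (a + b₁ + w₁) ≡ a + y + (w₁ + w) + (a₁ + b₁)
    shuffleʳ = solve-∀

  record Split (a b c : ℕ) (x y w : ℕ) : Set where
    constructor split
    field
      {front back} : List Move
      {row w₁ w₂}  : ℕ
      first        : Walk a b front row c w₁
      second       : Walk row c back x y w₂
      total        : w ≡ w₁ + w₂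

  walk-split : ∀ {a b ms x y w} c → Walk a b ms x y w → b ≤ c → c ≤ y → Split a b c x y w
  walk-split {b = b} c p b≤c c≤y with b ≟ c
  walk-split c p b≤c c≤y | yes refl = split [] p refl
  walk-split c [] b≤c c≤y | no b≢c = ⊥-elim (b≢c (≤-antisym b≤c c≤y))
  walk-split {a} {b} c (_∷_ {w₁ = w₁} e p) b≤c c≤y | no b≢c
    with walk-split c p (≤-trans (EdgeBounds.column+1 (edge-bounds (edge a b _ e))) (≤∧≢⇒< b≤c b≢c)) c≤y
  ... | split {w₁ = u₁} {u₂} p₁ p₂ refl = split (e ∷ p₁) p₂ (sym (+-assoc w₁ u₁ u₂))

  ≡ᵇ-refl : ∀ x → (x ≡ᵇ x) ≡ true
  ≡ᵇ-refl zero    = refl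
  ≡ᵇ-refl (suc x) = ≡ᵇ-refl x

  pathWeight-walk : ∀ {a b ms x y w} → Walk a b ms x y w → pathWeight a b x y ms ≡ fin w
  pathWeight-walk {x = x} {y} p rewrite walk-sound p | ≡ᵇ-refl x | ≡ᵇ-refl y = refl

  pathWeight-fin : ∀ a b x y ms {w} → pathWeight a b x y ms ≡ fin w → Walk a b ms x y w
  pathWeight-fin a b x y ms e with walk a b ms in eq
  ... | just (x' , y' , w') with x' ≡ᵇ x in ex | y' ≡ᵇ y in ey
  pathWeight-fin a b x y ms refl | just (x' , y' , w') | true | true
    rewrite ≡ᵇ⇒≡ x' x (subst T (sym ex) tt) | ≡ᵇ⇒≡ y' y (subst T (sym ey) tt) = walk-complete a b ms eq

  dist-≤ : ∀ {a b ms x y w} → Walk a b ms x y w → dist a b x y ≤∞ fin w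
  dist-≤ {a} {b} {ms} {x} {y} p =
    subst (dist a b x y ≤∞_) (pathWeight-walk p)
          (minimum∞-≤ (pathWeight a b x y) (movesUpTo-complete _ ms short))
    where
    open WalkBounds (walk-bounds p)
    short : length ms ≤ (x ∸ a) + (y ∸ b)
    short = +-cancelʳ-≤ (a + b) _ _ (≤-trans length≤ (≤-reflexive (begin
      x + y                     ≡⟨ cong₂ _+_ (m∸n+n≡m rows) (m∸n+n≡m columns) ⟨
      (x ∸ a + a) + (y ∸ b + b) ≡⟨ +-shuffle (x ∸ a) a (y ∸ b) b ⟩
      (x ∸ a) + (y ∸ b) + (a + b) ∎)))
      where
      open ≡-Reasoning
      +-shuffle : ∀ u a v b → u + a + (v + b) ≡ u + v + (a + b)
      +-shuffle = solve-∀

  dist-attained : ∀ a b x y {w} → dist a b x y ≡ fin w → ∃ λ ms → Walk a b ms x y w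
  dist-attained a b x y {w} e with minimum∞-attained (pathWeight a b x y) (movesUpTo ((x ∸ a) + (y ∸ b))) w e
  ... | ms , _ , pw = ms , pathWeight-fin a b x y ms pw

  dist-triangle : ∀ a b a' b' x y → dist a b x y ≤∞ dist a b a' b' ⊕ dist a' b' x y
  dist-triangle a b a' b' x y with dist a b a' b' in e₁ | dist a' b' x y in e₂
  ... | fin u | fin v with dist-attained a b a' b' e₁ | dist-attained a' b' x y e₂
  ...   | _ , p | _ , q = dist-≤ (p ++ʷ q)
  dist-triangle a b a' b' x y | fin u | ∞ = tt
  dist-triangle a b a' b' x y | ∞     | _ = tt

  rowCost : ℕ → ℕ
  rowCost zero    = 0
  rowCost (suc _) = 1

  step-H : ∀ a b → step a b H ≡ just (a , suc b , rowCost a)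
  step-H zero    b = refl
  step-H (suc a) b = refl

  step-V : ∀ a b → a < n → step a b V ≡ just (suc a , b , 1)
  step-V zero b 0<n with 0 <? n
  ... | yes _   = refl
  ... | no 0≮n = ⊥-elim (0≮n 0<n)
  step-V (suc a) b a<n with suc a <? n
  ... | yes _   = refl
  ... | no a≮n = ⊥-elim (a≮n a<n)

  walk-down : ∀ a b → a < n → Walk a b (V ∷ []) (suc a) b 1
  walk-down a b a<n = step-V a b a<n ∷ []

  walk-right : ∀ a b k → Walk a b (replicate k H) a (k + b) (k * rowCost a)
  walk-right a b zero    = []
  walk-right a b (suc k) =
    subst (λ y → Walk a b (replicate (suc k) H) a y (suc k * rowCost a)) (+-suc k b)
          (step-H a b ∷ walk-right a (suc b) k)

  -- ED(a , i) ≤ a: go right along the free top row, then straight down.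
  ED-≤ : ∀ a i → a ≤ n → ED a i ≤∞ fin a
  ED-≤ zero    i _   = subst₂ (λ y w → dist 0 0 0 y ≤∞ fin w) (+-identityʳ (suc i)) (*-zeroʳ (suc i))
                              (dist-≤ (walk-right 0 0 (suc i)))
  ED-≤ (suc a) i a<n = ≤∞-trans (ED (suc a) i) _ (fin (suc a))
    (dist-triangle 0 0 a (suc i) (suc a) (suc i))
    (subst (ED a i ⊕ dist a (suc i) (suc a) (suc i) ≤∞_) (cong fin (+-comm a 1))
      (⊕-mono-≤∞ (ED a i) (fin a) _ (fin 1) (ED-≤ a i (<⇒≤ a<n)) (dist-≤ (walk-down a (suc i) a<n))))

  ed : ℕ → ℕ → ℕ
  ed a i = value (ED a i)

  ED-fin : ∀ {a} i → a ≤ n → ED a i ≡ fin (ed a i)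
  ED-fin {a} i a≤n with ≤∞-fin (ED a i) a (ED-≤ a i a≤n)
  ... | e , eq , _ rewrite eq = refl

  ed-≤ : ∀ {a} i → a ≤ n → ed a i ≤ a
  ed-≤ {a} i a≤n with ≤∞-fin (ED a i) a (ED-≤ a i a≤n)
  ... | e , eq , e≤a rewrite eq = e≤a

  ed-via : ∀ {a a' c i w} → a' ≤ n → a ≤ n → dist a' (suc c) a (suc i) ≤∞ fin w → ed a i ≤ ed a' c + w
  ed-via {a} {a'} {c} {i} {w} a'≤n a≤n tail =
    subst₂ _≤∞_ (ED-fin i a≤n) (cong (_⊕ fin w) (ED-fin c a'≤n))
      (≤∞-trans (ED a i) _ (ED a' c ⊕ fin w) (dist-triangle 0 0 a' (suc c) a (suc i))
        (⊕-mono-≤∞ (ED a' c) (ED a' c) _ (fin w) (≤∞-refl (ED a' c)) tail))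

  ed-down : ∀ {t} i → t < n → ed (suc t) i ≤ suc (ed t i)
  ed-down {t} i t<n = subst (ed (suc t) i ≤_) (+-comm (ed t i) 1)
    (ed-via (<⇒≤ t<n) t<n (dist-≤ (walk-down t (suc i) t<n)))

  ed-rows : ∀ {a t} i → a ≤ t → t ≤ n → ed t i + a ≤ ed a i + t
  ed-rows {a} {t} i a≤t t≤n with m≤n⇒m<n∨m≡n a≤t
  ... | inj₂ refl = ≤-refl
  ed-rows {a} {suc t} i _ t<n | inj₁ (s≤s a≤t) = begin
    ed (suc t) i + a   ≤⟨ +-monoˡ-≤ a (ed-down i t<n) ⟩
    suc (ed t i + a)   ≤⟨ s≤s (ed-rows i a≤t (<⇒≤ t<n)) ⟩
    suc (ed a i + t)   ≡⟨ +-suc (ed a i) t ⟨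
    ed a i + suc t     ∎
    where open ≤-Reasoning

  ed-right : ∀ {a c i} → a ≤ n → c ≤ i → ed a i ≤ ed a c + (i ∸ c)
  ed-right {a} {c} {i} a≤n c≤i = ≤-trans (ed-via a≤n a≤n (subst₂ (λ y w → dist a (suc c) a y ≤∞ fin w)
      column≡ refl (dist-≤ (walk-right a (suc c) (i ∸ c)))))
    (+-monoʳ-≤ (ed a c) (≤-trans (*-monoʳ-≤ (i ∸ c) (rowCost≤1 a)) (≤-reflexive (*-identityʳ (i ∸ c)))))
    where
    column≡ : i ∸ c + suc c ≡ suc i
    column≡ = trans (+-suc (i ∸ c) c) (cong suc (m∸n+n≡m c≤i))
    rowCost≤1 : ∀ a → rowCost a ≤ 1
    rowCost≤1 zero    = z≤n
    rowCost≤1 (suc _) = ≤-refl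

  record Crossing (a c i : ℕ) : Set where
    field
      row     : ℕ
      cost    : ℕ
      in-grid : row ≤ n
      tail    : dist row (suc c) a (suc i) ≤∞ fin cost
      optimal : ed row c + cost ≤ ed a i
      descent : a ≤ row + (i ∸ c) + cost

  crossing : ∀ {a} c i → a ≤ n → c ≤ i → Crossing a c i
  crossing {a} c i a≤n c≤i with dist-attained 0 0 a (suc i) (ED-fin i a≤n)
  ... | _ , p with walk-split (suc c) p z≤n (s≤s c≤i)
  ... | split {row = a'} {w₁} {w₂} p₁ p₂ total = record
    { row     = a'
    ; cost    = w₂
    ; in-grid = WalkBounds.in-grid (walk-bounds p₁) z≤n
    ; tail    = dist-≤ p₂
    ; optimal = subst (ed a' c + w₂ ≤_) (sym total) (+-monoˡ-≤ w₂ head)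
    ; descent = +-cancelʳ-≤ (suc c) _ _ (subst (a + suc c ≤_) column≡ (WalkBounds.descent (walk-bounds p₂))) }
    where
    head : ed a' c ≤ w₁
    head = subst (_≤∞ fin w₁) (ED-fin c (WalkBounds.in-grid (walk-bounds p₁) z≤n)) (dist-≤ p₁)
    column≡ : a' + suc i + w₂ ≡ a' + (i ∸ c) + w₂ + suc c
    column≡ = begin
      a' + suc i + w₂               ≡⟨ cong (λ y → a' + suc y + w₂) (m∸n+n≡m c≤i) ⟨
      a' + suc (i ∸ c + c) + w₂     ≡⟨ shuffle a' (i ∸ c) c w₂ ⟩
      a' + (i ∸ c) + w₂ + suc c     ∎
      where
      open ≡-Reasoning
      shuffle : ∀ a' d c w → a' + suc (d + c) + w ≡ a' + d + w + suc c
      shuffle = solve-∀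

blockIndex : ℕ → (ℕ → ℕ∞) → ℕ → ℕ
blockIndex N row a = lookupKey a (zip (downFrom (suc N)) (blocks (map row (downFrom (suc N)))))

nextBlock : ℕ → ℕ∞ → ℕ∞ → ℕ
nextBlock k p v = if continues true p v then k else suc k

blocksGo-fin : ∀ k p x vs →
  blocksGo k true p (fin x ∷ vs) ≡ nextBlock k p (fin x) ∷ blocksGo (nextBlock k p (fin x)) true (fin x) vs
blocksGo-fin k p x vs with continues true p (fin x)
... | true  = refl
... | false = refl

-- Going from a row with value y to the next row with value x ≥ y - 1, a new block starts
-- only if x ≥ y, so the invariant  block + F + row ≤ value + N + 1  is preserved.
nextBlock-bound : ∀ k F N j x y → y ≤ suc x → k + F + suc j ≤ y + N + 1 →
                  nextBlock k (fin y) (fin x) + F + j ≤ x + N + 1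
nextBlock-bound k F N j x y y≤1+x inv with suc x ≡ᵇ y in continues?
... | true rewrite sym (≡ᵇ⇒≡ (suc x) y (subst T (sym continues?) tt)) =
  ≤-pred (subst (_≤ suc x + N + 1) (+-suc (k + F) j) inv)
... | false = subst (_≤ x + N + 1) (+-suc (k + F) j)
  (≤-trans inv (+-monoˡ-≤ 1 (+-monoˡ-≤ N y≤x)))
  where
  y≤x : y ≤ x
  y≤x = ≤-pred (≤∧≢⇒< y≤1+x (λ y≡1+x → subst T continues? (≡⇒≡ᵇ (suc x) y (sym y≡1+x))))

module BlockBound (row : ℕ → ℕ∞) (f : ℕ → ℕ) (N a : ℕ)
  (row-fin : ∀ t → a ≤ t → t ≤ N → row t ≡ fin (f t))
  (f-step : ∀ t → a ≤ t → t < N → f (suc t) ≤ suc (f t)) where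

  private
    scan : ∀ j k → a < j → j ≤ N → k + f N + j ≤ f j + N + 1 →
           lookupKey a (zip (downFrom j) (blocksGo k true (fin (f j)) (map row (downFrom j)))) + f N + a
             ≤ f a + N + 1
    scan (suc j) k (s≤s a≤j) j<N inv
      rewrite row-fin j a≤j (<⇒≤ j<N) | blocksGo-fin k (fin (f (suc j))) (f j) (map row (downFrom j))
      with a ≡ᵇ j in here?
    ... | true rewrite ≡ᵇ⇒≡ a j (subst T (sym here?) tt) =
      nextBlock-bound k (f N) N j (f j) (f (suc j)) (f-step j ≤-refl j<N) inv
    ... | false = scan j _ (≤∧≢⇒< a≤j (λ a≡j → subst T here? (≡⇒≡ᵇ a j a≡j))) (<⇒≤ j<N)
      (nextBlock-bound k (f N) N j (f j) (f (suc j)) (f-step j a≤j j<N) inv)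

  blockIndex-bound : a ≤ N → blockIndex N row a + f N + a ≤ f a + N + 1
  blockIndex-bound a≤N rewrite row-fin N a≤N ≤-refl with a ≡ᵇ N in here?
  ... | true rewrite ≡ᵇ⇒≡ a N (subst T (sym here?) tt) = ≤-reflexive (+-comm 1 (f N + N))
  ... | false = scan N 1 (≤∧≢⇒< a≤N (λ a≡N → subst T here? (≡⇒≡ᵇ a N a≡N))) ≤-refl
      (≤-reflexive (+-comm 1 (f N + N)))

-- The slack of a row at column i survives the step back to column ρ(i) along an optimal path
-- (crossing column ρ(i) in row a' at cost e', the rest costing w), when the stripe of ρ(i) is at
-- least twice as wide as that of i ...
slack-wide : ∀ {e' w a a' d e eN eNr dr n} → e' + w ≤ e → a ≤ a' + d + w → e + n < eN + a + 3 * d →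
             eN ≤ eNr + d → 2 * d ≤ dr → e' + n < eNr + a' + 3 * dr
slack-wide {e'} {w} {a} {a'} {d} {e} {eN} {eNr} {dr} {n} optimal descent slack right wide =
  +-cancelʳ-≤ (w + a + e + eN + 5 * d) _ _
    (subst₂ _≤_ (regroupˡ e' w a e n eN d) (regroupʳ e a' d w eN a eNr dr)
      (+-mono-≤ optimal (+-mono-≤ descent (+-mono-≤ slack (+-mono-≤ right 5d≤3dr)))))
  where
  5d≤3dr : 5 * d ≤ 3 * dr
  5d≤3dr = ≤-trans (*-monoˡ-≤ d {5} {6} (n≤1+n 5)) (subst (_≤ 3 * dr) (6*≡3*2* d) (*-monoʳ-≤ 3 wide))
    where
    6*≡3*2* : ∀ d → 3 * (2 * d) ≡ 6 * d
    6*≡3*2* = solve-∀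
  regroupˡ : ∀ e' w a e n eN d →
    e' + w + (a + (suc (e + n) + (eN + 5 * d))) ≡ suc (e' + n) + (w + a + e + eN + 5 * d)
  regroupˡ = solve-∀
  regroupʳ : ∀ e a' d w eN a eNr dr →
    e + (a' + d + w + (eN + a + 3 * d + (eNr + d + 3 * dr))) ≡ eNr + a' + 3 * dr + (w + a + e + eN + 5 * d)
  regroupʳ = solve-∀

-- ... or when that stripe has the full width n, since ED(a' , ρ(i)) ≤ a'.
slack-capped : ∀ {e' a' eNr dr n} → e' ≤ a' → n ≤ dr → 1 ≤ n → e' + n < eNr + a' + 3 * dr
slack-capped {e'} {a'} {eNr} {dr} {n} e'≤a' n≤dr 1≤n = begin-strict
  e' + n                 ≤⟨ +-mono-≤ e'≤a' n≤dr ⟩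
  a' + dr                <⟨ +-monoʳ-< a' (m<m+n dr (≤-trans (≤-trans 1≤n n≤dr) (m≤m+n dr _))) ⟩
  a' + 3 * dr            ≤⟨ m≤n+m (a' + 3 * dr) eNr ⟩
  eNr + (a' + 3 * dr)    ≡⟨ +-assoc eNr a' (3 * dr) ⟨
  eNr + a' + 3 * dr      ∎
  where open ≤-Reasoning

if-true : ∀ {b} {A : Set} {x y : A} → T b → (if b then x else y) ≡ x
if-true {true} _ = refl

module Correctness {A : Set} (_≟A_ : DecidableEquality A) (K : ℕ) (F : Fin (2 ^ K) → A) (S : ℕ → A) where

  n : ℕ
  n = 2 ^ K

  open Setup _≟A_ n F S
  open Paths _≟A_ n F S
  open Crossing

  1≤n : 1 ≤ n
  1≤n = m^n>0 2 K

  Slack : ℕ → ℕ → Set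
  Slack i a = ed a i + n < ed n i + a + 3 * gap n i

  -- The band is closed downwards, since ED rises by at most one per row.
  slack-below : ∀ {i a t} → Slack i a → a ≤ t → t ≤ n → Slack i t
  slack-below {i} {a} {t} slack a≤t t≤n = +-cancelʳ-≤ (ed a i + a) _ _
    (subst₂ _≤_ (regroupˡ (ed t i) a (ed a i) n) (regroupʳ (ed a i) t (ed n i) a (3 * gap n i))
      (+-mono-≤ (ed-rows i a≤t t≤n) slack))
    where
    regroupˡ : ∀ et a ea n → et + a + suc (ea + n) ≡ suc (et + n) + (ea + a)
    regroupˡ = solve-∀
    regroupʳ : ∀ ea t eN a g → ea + t + (eN + a + g) ≡ eN + t + g + (ea + a)
    regroupʳ = solve-∀

  Sound : ℕ → ℕ → Set
  Sound k i = ∀ a → a ≤ n → ED a i ≤∞ Drow k i a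

  Exact : ℕ → ℕ → Set
  Exact k i = ∀ a → a ≤ n → Slack i a → Drow k i a ≡ ED a i

  module Step (k i' : ℕ) (sound : Sound k (ρ n (suc i'))) (exact : Exact k (ρ n (suc i'))) where
    i r : ℕ
    i = suc i'
    r = ρ n i

    r<i : r < i
    r<i = ρ< n i 1≤n (s≤s z≤n)

    D̃ : ℕ → ℕ∞
    D̃ = Dtilde (Drow k r) r i

    candidate : ℕ → ℕ → ℕ∞
    candidate a a' = Drow k r a' ⊕ dist a' (suc r) a (suc i)

    -- Every candidate of the minimum defining D̃ is at least the cost of a genuine path.
    D̃-sound : ∀ a → ED a i ≤∞ D̃ a
    D̃-sound a = minimum∞-glb (candidate a) (upTo (suc n)) (ED a i) λ {a'} mem →
      ≤∞-trans (ED a i) _ (candidate a a') (dist-triangle 0 0 a' (suc r) a (suc i))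
        (⊕-mono-≤∞ (ED a' r) _ _ _ (sound a' (≤-pred (∈-upTo⁻ mem))) (≤∞-refl (dist a' (suc r) a (suc i))))

    crossing-exact : ∀ {a} → Slack i a → (X : Crossing a r i) → Drow k r (row X) ≡ ED (row X) r
    crossing-exact {a} slack X with gap-growth K i (s≤s z≤n)
    ... | inj₁ r≡0 = subst (λ r → Drow k r (row X) ≡ ED (row X) r) (sym r≡0) refl
    ... | inj₂ (inj₁ wide) = exact (row X) (in-grid X)
      (slack-wide {ed (row X) r} {cost X} {a} {row X} {gap n i} {ed a i} {ed n i} {ed n r} {gap n r} {n}
        (optimal X) (descent X) slack (ed-right ≤-refl (<⇒≤ r<i)) wide)
    ... | inj₂ (inj₂ capped) = exact (row X) (in-grid X) (slack-capped {eNr = ed n r} (ed-≤ r (in-grid X)) capped 1≤n)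

    D̃-exact : ∀ a → a ≤ n → Slack i a → D̃ a ≡ ED a i
    D̃-exact a a≤n slack = trans (≤∞-antisym-fin (D̃ a) (ed a i) lower upper) (sym (ED-fin i a≤n))
      where
      X : Crossing a r i
      X = crossing r i a≤n (<⇒≤ r<i)
      lower : fin (ed a i) ≤∞ D̃ a
      lower = subst (_≤∞ D̃ a) (ED-fin i a≤n) (D̃-sound a)
      upper : D̃ a ≤∞ fin (ed a i)
      upper = ≤∞-trans (D̃ a) (candidate a (row X)) (fin (ed a i))
        (minimum∞-≤ (candidate a) (∈-upTo⁺ (s≤s (in-grid X))))
        (subst (λ x → x ⊕ dist (row X) (suc r) a (suc i) ≤∞ fin (ed a i))
          (sym (trans (crossing-exact slack X) (ED-fin r (in-grid X))))
          (≤∞-trans _ (fin (ed (row X) r + cost X)) (fin (ed a i))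
            (⊕-mono-≤∞ (fin (ed (row X) r)) _ _ (fin (cost X)) ≤-refl (tail X)) (optimal X)))

    block-bound : ∀ a → a ≤ n → Slack i a → blockOf D̃ a ≤ 3 * gap n i
    block-bound a a≤n slack = +-cancelʳ-≤ (ed n i + a) _ _ (begin
      blockOf D̃ a + (ed n i + a)   ≡⟨ +-assoc (blockOf D̃ a) (ed n i) a ⟨
      blockOf D̃ a + ed n i + a     ≤⟨ blockIndex-bound a≤n ⟩
      ed a i + n + 1               ≡⟨ +-comm (ed a i + n) 1 ⟩
      suc (ed a i + n)             ≤⟨ slack ⟩
      ed n i + a + 3 * gap n i     ≡⟨ +-comm (ed n i + a) (3 * gap n i) ⟩
      3 * gap n i + (ed n i + a)   ∎)
      where
      open ≤-Reasoning
      open BlockBound D̃ (λ t → ed t i) n a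
        (λ t a≤t t≤n → trans (D̃-exact t t≤n (slack-below slack a≤t t≤n)) (ED-fin i t≤n))
        (λ t _ t<n → ed-down i t<n)

    -- Pruning by the block threshold only ever replaces values by ∞ ...
    sound′ : Sound (suc k) i
    sound′ a a≤n with blockOf D̃ a ≤ᵇ 3 * gap n i
    ... | true  = D̃-sound a
    ... | false = tt

    -- ... and never on the slack band.
    exact′ : Exact (suc k) i
    exact′ a a≤n slack = trans (if-true (≤⇒≤ᵇ (block-bound a a≤n slack))) (D̃-exact a a≤n slack)

  sound-exact : ∀ k i → i ≤ k → Sound k i × Exact k i
  sound-exact k       zero    _         = (λ a _ → ≤∞-refl (ED a 0)) , (λ a _ _ → refl)
  sound-exact (suc k) (suc i) (s≤s i≤k)
    with sound-exact k (ρ n (suc i)) (≤-trans (≤-pred (ρ< n (suc i) 1≤n (s≤s z≤n))) i≤k)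
  ... | sound , exact = Step.sound′ k i sound exact , Step.exact′ k i sound exact

  -- The bottom row is always in the slack band, so D is exact there.
  D-last-row : ∀ i → D n i ≡ ED n i
  D-last-row zero    = refl
  D-last-row (suc i) = proj₂ (sound-exact (suc i) (suc i) ≤-refl) n ≤-refl
    (m<m+n (ed n (suc i) + n) (≤-trans (m<n⇒0<n∸m (ρ< n (suc i) 1≤n (s≤s z≤n))) (m≤m+n _ _)))

-- The theorem: for n a power of two, D(n-1 , i) = ED(n-1 , i) (row a = n in shifted coordinates).
lemma15 : {A : Set} (_≟A_ : DecidableEquality A) (n : ℕ) → (∃ λ k → n ≡ 2 ^ k) →
          (F : Fin n → A) (S : ℕ → A) (i : ℕ) →
          Setup.D _≟A_ n F S n i ≡ Setup.ED _≟A_ n F S n i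
lemma15 _≟A_ .(2 ^ K) (K , refl) F S i = Correctness.D-last-row _≟A_ K F S i
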